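{- For every digraph $D$, ${\rm ndi}(D)\le 2\Delta^*(D)$.
   Context: All digraphs are finite, without loops and without multiple arcs (opposite arcs allowed). For a vertex $u$, $d_D^+(u)$, $d_D^-(u)$ denote outdegree and indegree; $\Delta^*(D)=\max\{\max_u d_D^+(u),\max_u d_D^-(u)\}$. A (proper) $k$-arc-colouring of $D$ is a map $\gamma$ from $A(D)$ to a set of $k$ colours such that arcs with the same head get distinct colours and arcs with the same tail get distinct colours. $S_\gamma^+(u)$, $S_\gamma^-(u)$ are the sets of colours on arcs with tail $u$, resp. head $u$. $\gamma$ is neighbour-distinguishing if for every arc $uv$, $(S_\gamma^+(u),S_\gamma^-(u))\neq(S_\gamma^+(v),S_\gamma^-(v))$ as ordered pairs. ${\rm ndi}(D)$ is the minimum number of colours of a neighbour-distinguishing arc-colouring of $D$. -}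

module Defs where

open import Data.Nat using (ℕ; _⊔_; _*_)
open import Data.Bool using (Bool; true; false; if_then_else_)
open import Data.Fin using (Fin)
open import Data.List using (List; map; foldr; allFin)
open import Data.Nat.ListAction using (sum)
open import Data.Product using (Σ; ∃; _×_; _,_)
open import Relation.Binary.PropositionalEquality using (_≡_; _≢_)
open import Relation.Nullary using (¬_)
open import Function.Bundles using (_⇔_)

-- A finite digraph on vertex set Fin n: arcs given by a Boolean adjacency
-- relation (no multiple arcs), no loops; opposite arcs are allowed.
record Digraph : Set where
  field
    n     : ℕ
    adj   : Fin n → Fin n → Bool
    loopless : ∀ u → adj u u ≡ false

open Digraph public

Vertex : Digraph → Set
Vertex D = Fin (n D)

Arc : (D : Digraph) → Vertex D → Vertex D → Set
Arc D u v = adj D u v ≡ true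

outdeg : (D : Digraph) → Vertex D → ℕ
outdeg D u = sum (map (λ v → if adj D u v then 1 else 0) (allFin (n D)))

indeg : (D : Digraph) → Vertex D → ℕ
indeg D u = sum (map (λ v → if adj D v u then 1 else 0) (allFin (n D)))

maxList : List ℕ → ℕ
maxList = foldr _⊔_ 0

-- Δ*(D) = max of all out- and indegrees (0 for the empty digraph)
Δ* : Digraph → ℕ
Δ* D = maxList (map (outdeg D) (allFin (n D))) ⊔ maxList (map (indeg D) (allFin (n D)))

ArcColouring : Digraph → ℕ → Set
ArcColouring D k = (u v : Vertex D) → Arc D u v → Fin k

Proper : (D : Digraph) {k : ℕ} → ArcColouring D k → Set
Proper D γ =
  (∀ u v w (p : Arc D u v) (q : Arc D u w) → v ≢ w → γ u v p ≢ γ u w q) ×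
  (∀ u v w (p : Arc D u w) (q : Arc D v w) → u ≢ v → γ u w p ≢ γ v w q)

InS⁺ : (D : Digraph) {k : ℕ} → ArcColouring D k → Vertex D → Fin k → Set
InS⁺ D γ u c = ∃ λ v → Σ (Arc D u v) λ p → γ u v p ≡ c

InS⁻ : (D : Digraph) {k : ℕ} → ArcColouring D k → Vertex D → Fin k → Set
InS⁻ D γ u c = ∃ λ v → Σ (Arc D v u) λ p → γ v u p ≡ c

SamePair : (D : Digraph) {k : ℕ} → ArcColouring D k → Vertex D → Vertex D → Set
SamePair D γ u v = ∀ c → (InS⁺ D γ u c ⇔ InS⁺ D γ v c) × (InS⁻ D γ u c ⇔ InS⁻ D γ v c)

NeighbourDistinguishing : (D : Digraph) {k : ℕ} → ArcColouring D k → Set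
NeighbourDistinguishing D γ = ∀ u v → Arc D u v → ¬ SamePair D γ u v

-- D has a neighbour-distinguishing (proper) k-arc-colouring, i.e. ndi(D) ≤ k
-- (a colouring with ≤ k colours is a colouring into a set of k colours)
HasNDColouring : Digraph → ℕ → Set
HasNDColouring D k = Σ (ArcColouring D k) λ γ → Proper D γ × NeighbourDistinguishing D γ

module Submission where

-- First, König's
-- theorem (for the bipartite tail/head graph of D) gives a proper colouring c
-- of the arcs with Δ = Δ*(D) colours; it is built by deleting an arc xy,
-- colouring the rest by induction on the number of arcs, and re-inserting xy
-- after swapping two colours along an alternating (Kempe) chain.  Second, a
-- local search attaches a bit b to every arc so that no directed 3-path
-- w → u → v → x has all three arcs equal in both c and b: flipping the bit of
-- the middle arc of such a path strictly decreases the number of arcs that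
-- are continued at their head by an arc with the same colour and bit.  The
-- pair (b, c), encoded in Fin (2 * Δ), is then a proper colouring, and it is
-- neighbour-distinguishing: if an arc uv had (S⁺(u), S⁻(u)) = (S⁺(v), S⁻(v)),
-- its colour would lie on an out-arc vx of v and on an in-arc wu of u, giving
-- exactly such a 3-path.  (When Δ*(D) = 0 there are no arcs at all.)

open import Defs
open import Data.Nat using (ℕ; zero; suc; _*_; _≤_; _<_; z≤n; s≤s)
open import Data.Nat.Properties
  using (≤-refl; ≤-trans; <-≤-trans; ≤-pred; <⇒≤; <⇒≱; <-irrefl; ≰⇒>; _≤?_; n<1+n;
         +-mono-≤; +-mono-<-≤; +-mono-≤-<; m≤m⊔n; m≤n⊔m; m≤n⇒m<n∨m≡n)
open import Data.Nat.Induction using (<-wellFounded)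
open import Data.Nat.ListAction using (sum)
open import Data.Bool using (Bool; true; false; if_then_else_; not)
open import Data.Bool.Properties using (not-¬) renaming (_≟_ to _≟ᵇ_)
open import Data.Fin using (Fin; zero; suc; toℕ; fromℕ<; combine)
open import Data.Fin.Properties
  using (_≟_; any?; all?; ¬∀⟶∃¬; pigeonhole; suc-injective; toℕ<n; toℕ-fromℕ<; combine-injective)
import Data.Fin.Permutation.Components as Perm
open import Data.List using (tabulate)
open import Data.List.Properties using (map-tabulate)
open import Data.List.Membership.Propositional using (_∈_)
open import Data.List.Membership.Propositional.Properties using (∈-map⁺; ∈-allFin)
open import Data.List.Relation.Unary.Any using (here; there)
open import Data.Product using (Σ; ∃; _×_; _,_; proj₁; proj₂)
open import Data.Sum using (_⊎_; inj₁; inj₂)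
open import Data.Empty using (⊥; ⊥-elim)
open import Function using (_∘_; id)
open import Function.Bundles using (Equivalence)
open import Function.Definitions using (Injective)
open import Induction.WellFounded using (module All)
import Relation.Binary.Construct.On as On
open import Relation.Binary.PropositionalEquality
  using (_≡_; _≢_; refl; sym; trans; cong; subst; module ≡-Reasoning)
open import Relation.Nullary using (¬_; Dec; yes; no; does)
open import Relation.Nullary.Decidable using (_×-dec_; dec-true; dec-false)
open import Level using (0ℓ)

variable
  N k : ℕ

measureRec : {S : Set} (μ : S → ℕ) (P : S → Set) →
             (∀ s → (∀ s' → μ s' < μ s → P s') → P s) → ∀ s → P s
measureRec μ P step =
  All.wfRec (On.wellFounded μ <-wellFounded) 0ℓ P (λ s rec → step s (λ s' lt → rec lt))

localSearch : {S : Set} (μ : S → ℕ) (Good : S → Set) →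
              (∀ s → Good s ⊎ ∃ λ s' → μ s' < μ s) → S → ∃ Good
localSearch μ Good improve = measureRec μ (λ _ → ∃ Good) search
  where
  search : ∀ s → (∀ s' → μ s' < μ s → ∃ Good) → ∃ Good
  search s rec with improve s
  ... | inj₁ good = s , good
  ... | inj₂ (s' , smaller) = rec s' smaller

dec-sound : {P : Set} (P? : Dec P) → does P? ≡ true → P
dec-sound (yes p) _ = p

count : (Fin N → Bool) → ℕ
count R = sum (tabulate (λ v → if R v then 1 else 0))

_⊆_ : (Fin N → Bool) → (Fin N → Bool) → Set
R ⊆ Q = ∀ v → R v ≡ true → Q v ≡ true

sum-mono : {f g : Fin N → ℕ} → (∀ i → f i ≤ g i) → sum (tabulate f) ≤ sum (tabulate g)
sum-mono {zero} f≤g = z≤n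
sum-mono {suc N} f≤g = +-mono-≤ (f≤g zero) (sum-mono (f≤g ∘ suc))

sum-strict : {f g : Fin N → ℕ} → (∀ i → f i ≤ g i) → ∀ j → f j < g j →
             sum (tabulate f) < sum (tabulate g)
sum-strict {suc N} f≤g zero fj<gj = +-mono-<-≤ fj<gj (sum-mono (f≤g ∘ suc))
sum-strict {suc N} f≤g (suc j) fj<gj = +-mono-≤-< (f≤g zero) (sum-strict (f≤g ∘ suc) j fj<gj)

indicator-mono : {a b : Bool} → (a ≡ true → b ≡ true) → (if a then 1 else 0) ≤ (if b then 1 else 0)
indicator-mono {false} a⇒b = z≤n
indicator-mono {true} a⇒b rewrite a⇒b refl = ≤-refl

count-mono : {R Q : Fin N → Bool} → R ⊆ Q → count R ≤ count Q
count-mono R⊆Q = sum-mono (λ v → indicator-mono (R⊆Q v))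

count-strict : {R Q : Fin N → Bool} {w : Fin N} → R ⊆ Q → R w ≡ false → Q w ≡ true →
               count R < count Q
count-strict R⊆Q Rw Qw = sum-strict (λ v → indicator-mono (R⊆Q v)) _ (indicator-strict Rw Qw)
  where
  indicator-strict : {a b : Bool} → a ≡ false → b ≡ true → (if a then 1 else 0) < (if b then 1 else 0)
  indicator-strict refl refl = s≤s z≤n

remove : (Fin N → Bool) → Fin N → Fin N → Bool
remove R w v = if does (v ≟ w) then false else R v

remove-keeps : (R : Fin N → Bool) {w v : Fin N} → R v ≡ true → v ≢ w → remove R w v ≡ true
remove-keeps R {w} {v} Rv v≢w with v ≟ w
... | yes v≡w = ⊥-elim (v≢w v≡w)
... | no _ = Rv

count-remove : (R : Fin N → Bool) (w : Fin N) → R w ≡ true → count R ≡ suc (count (remove R w))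
count-remove {suc N} R zero Rw rewrite Rw = refl
count-remove {suc N} R (suc w) Rw with R zero
... | true = cong suc (count-remove (R ∘ suc) w Rw)
... | false = count-remove (R ∘ suc) w Rw

injection-bound : ∀ {m} (R : Fin N → Bool) (f : Fin m → Fin N) → Injective _≡_ _≡_ f →
                  (∀ i → R (f i) ≡ true) → m ≤ count R
injection-bound {m = zero} R f f-inj f∈R = z≤n
injection-bound {m = suc m} R f f-inj f∈R =
  subst (suc m ≤_) (sym (count-remove R (f zero) (f∈R zero)))
    (s≤s (injection-bound (remove R (f zero)) (f ∘ suc) (suc-injective ∘ f-inj) kept))
  where
  kept : ∀ i → remove R (f zero) (f (suc i)) ≡ true
  kept i = remove-keeps R (f∈R (suc i)) (λ e → zero≢suc (f-inj (sym e)))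
    where
    zero≢suc : Fin.zero ≢ suc i
    zero≢suc ()

count-positive : (R : Fin N → Bool) {v : Fin N} → R v ≡ true → 1 ≤ count R
count-positive R {v} Rv =
  injection-bound R (λ (_ : Fin 1) → v) (λ { {zero} {zero} _ → refl }) (λ _ → Rv)

freeColour : (R : Fin N → Bool) (g : Fin N → Fin k) → count R < k →
             ∃ λ α → ∀ z → R z ≡ true → g z ≢ α
freeColour {N} {k} R g small = fromDec (all? used?)
  where
  Used : Fin k → Set
  Used α = ∃ λ z → R z ≡ true × g z ≡ α
  used? : ∀ α → Dec (Used α)
  used? α = any? (λ z → (R z ≟ᵇ true) ×-dec (g z ≟ α))
  fromDec : Dec (∀ α → Used α) → ∃ λ α → ∀ z → R z ≡ true → g z ≢ α
  fromDec (yes allUsed) = ⊥-elim (<⇒≱ small (injection-bound R witness witness-inj witness∈R))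
    where
    witness : Fin k → Fin N
    witness α = proj₁ (allUsed α)
    witness∈R : ∀ α → R (witness α) ≡ true
    witness∈R α = proj₁ (proj₂ (allUsed α))
    witness-inj : Injective _≡_ _≡_ witness
    witness-inj {α} {α'} e =
      trans (sym (proj₂ (proj₂ (allUsed α)))) (trans (cong g e) (proj₂ (proj₂ (allUsed α'))))
  fromDec (no notAll) with ¬∀⟶∃¬ k Used used? notAll
  ... | α , unused = α , λ z Rz gz≡α → unused (z , Rz , gz≡α)

Rel : ℕ → Set
Rel N = Fin N → Fin N → Bool

size : Rel N → ℕ
size E = sum (tabulate (λ u → count (E u)))

size-strict : {E F : Rel N} {x y : Fin N} → (∀ u → E u ⊆ F u) → E x y ≡ false → F x y ≡ true →
              size E < size F
size-strict {x = x} E⊆F Exy Fxy =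
  sum-strict (λ u → count-mono (E⊆F u)) x (count-strict (E⊆F x) Exy Fxy)

adjustAt : {A : Set} → (Fin N → Fin N → A) → Fin N → Fin N → (A → A) → Fin N → Fin N → A
adjustAt g x y h u v with (u ≟ x) ×-dec (v ≟ y)
... | yes _ = h (g u v)
... | no _ = g u v

adjustAt-here : {A : Set} (g : Fin N → Fin N → A) (x y : Fin N) (h : A → A) →
                adjustAt g x y h x y ≡ h (g x y)
adjustAt-here g x y h with (x ≟ x) ×-dec (y ≟ y)
... | yes _ = refl
... | no ne = ⊥-elim (ne (refl , refl))

adjustAt-elsewhere : {A : Set} (g : Fin N → Fin N → A) {x y u v : Fin N} (h : A → A) →
                     ¬ (u ≡ x × v ≡ y) → adjustAt g x y h u v ≡ g u v
adjustAt-elsewhere g {x} {y} {u} {v} h ne with (u ≟ x) ×-dec (v ≟ y)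
... | yes eq = ⊥-elim (ne eq)
... | no _ = refl

deleteArc : Rel N → Fin N → Fin N → Rel N
deleteArc E x y = adjustAt E x y (λ _ → false)

deleteArc-deleted : (E : Rel N) (x y : Fin N) → deleteArc E x y x y ≡ false
deleteArc-deleted E x y = adjustAt-here E x y _

module _ {E : Rel N} {x y : Fin N} where

  deleteArc-⊆ : ∀ u → deleteArc E x y u ⊆ E u
  deleteArc-⊆ u v h with (u ≟ x) ×-dec (v ≟ y)
  deleteArc-⊆ u v () | yes _
  deleteArc-⊆ u v h | no _ = h

  deleteArc-split : ∀ {u v} → E u v ≡ true → (u ≡ x × v ≡ y) ⊎ deleteArc E x y u v ≡ true
  deleteArc-split {u} {v} h with (u ≟ x) ×-dec (v ≟ y)
  ... | yes uv≡xy = inj₁ uv≡xy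
  ... | no _ = inj₂ h

  deleteArc-not-xy : ∀ {u v} → deleteArc E x y u v ≡ true → ¬ (u ≡ x × v ≡ y)
  deleteArc-not-xy {u} {v} h uv≡xy with (u ≟ x) ×-dec (v ≟ y)
  deleteArc-not-xy () uv≡xy | yes _
  ... | no ne = ne uv≡xy

-- Colourings of all pairs of vertices; only their values on arcs matter.
Colouring : ℕ → ℕ → Set
Colouring N k = Fin N → Fin N → Fin k

TailInjective : Rel N → Colouring N k → Set
TailInjective E c = ∀ u v v' → E u v ≡ true → E u v' ≡ true → c u v ≡ c u v' → v ≡ v'

HeadInjective : Rel N → Colouring N k → Set
HeadInjective E c = ∀ u u' v → E u v ≡ true → E u' v ≡ true → c u v ≡ c u' v → u ≡ u'

ProperOn : Rel N → Colouring N k → Set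
ProperOn E c = TailInjective E c × HeadInjective E c

DegreeBounded : Rel N → ℕ → Set
DegreeBounded E k = (∀ u → count (E u) ≤ k) × (∀ v → count (λ w → E w v) ≤ k)

deleteArc-bounded : {E : Rel N} {x y : Fin N} → DegreeBounded E k → DegreeBounded (deleteArc E x y) k
deleteArc-bounded (out≤ , in≤) =
  (λ u → ≤-trans (count-mono (deleteArc-⊆ u)) (out≤ u)) ,
  (λ v → ≤-trans (count-mono (λ w → deleteArc-⊆ w v)) (in≤ v))

-- Let Z be the set of vertices reached from y by
-- alternately walking back along an α-arc and forward along a β-arc.
-- Swapping α and β on all arcs entering Z frees α at y while keeping it free
-- at x, so xy can then be coloured α.
module KempeStep (E : Rel N) (x y : Fin N) (γ : Colouring N k)
  (γ-proper : ProperOn (deleteArc E x y) γ) (α β : Fin k)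
  (α-free : ∀ z → deleteArc E x y x z ≡ true → γ x z ≢ α)
  (β-free : ∀ w → deleteArc E x y w y ≡ true → γ w y ≢ β) where

  E' : Rel N
  E' = deleteArc E x y

  tail-inj : TailInjective E' γ
  tail-inj = proj₁ γ-proper

  head-inj : HeadInjective E' γ
  head-inj = proj₂ γ-proper

  Step : Fin N → Fin N → Set
  Step z z' = ∃ λ w → E' w z ≡ true × γ w z ≡ α × E' w z' ≡ true × γ w z' ≡ β

  step? : ∀ z z' → Dec (Step z z')
  step? z z' =
    any? (λ w → (E' w z ≟ᵇ true) ×-dec (γ w z ≟ α) ×-dec (E' w z' ≟ᵇ true) ×-dec (γ w z' ≟ β))

  step-injective : ∀ {z₁ z₂ z} → Step z₁ z → Step z₂ z → z₁ ≡ z₂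
  step-injective (w₁ , e₁ , a₁ , f₁ , b₁) (w₂ , e₂ , a₂ , f₂ , b₂)
    with refl ← head-inj w₁ w₂ _ f₁ f₂ (trans b₁ (sym b₂)) =
    tail-inj w₁ _ _ e₁ e₂ (trans a₁ (sym a₂))

  data Chain : ℕ → Fin N → Set where
    start : Chain 0 y
    next : ∀ {i z z'} → Chain i z → Step z z' → Chain (suc i) z'

  -- y has no predecessor (β is free at y), so z determines the chain length.
  chain-length-unique : ∀ {i j z} → Chain i z → Chain j z → i ≡ j
  chain-length-unique start start = refl
  chain-length-unique start (next _ (w , _ , _ , wy , γwy≡β)) = ⊥-elim (β-free w wy γwy≡β)
  chain-length-unique (next _ (w , _ , _ , wy , γwy≡β)) start = ⊥-elim (β-free w wy γwy≡β)
  chain-length-unique (next c₁ s₁) (next c₂ s₂) with refl ← step-injective s₁ s₂ =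
    cong suc (chain-length-unique c₁ c₂)

  chain? : ∀ i z → Dec (Chain i z)
  chain? zero z with z ≟ y
  ... | yes refl = yes start
  ... | no z≢y = no λ { start → z≢y refl }
  chain? (suc i) z' with any? (λ z → chain? i z ×-dec step? z z')
  ... | yes (z , c , s) = yes (next c s)
  ... | no none = no λ { (next c s) → none (_ , c , s) }

  chain-prefix : ∀ {i z} j → j ≤ i → Chain i z → ∃ (Chain j)
  chain-prefix zero _ start = y , start
  chain-prefix j j≤i (next c s) with m≤n⇒m<n∨m≡n j≤i
  ... | inj₁ j<i = chain-prefix j (≤-pred j<i) c
  ... | inj₂ refl = _ , next c s

  -- There are no chains of all lengths 0, …, N: their N + 1 endpoints in
  -- Fin N would repeat, against chain-length-unique.
  not-all-lengths : ((j : Fin (suc N)) → ∃ (Chain (toℕ j))) → ⊥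
  not-all-lengths chainOf with pigeonhole (n<1+n N) (proj₁ ∘ chainOf)
  ... | j₁ , j₂ , j₁<j₂ , same =
    <-irrefl (chain-length-unique (proj₂ (chainOf j₁)) (subst (Chain _) (sym same) (proj₂ (chainOf j₂))))
             j₁<j₂

  -- Hence chains have length at most N (a longer one has all shorter prefixes).
  chain-short : ∀ {i z} → Chain i z → i < suc N
  chain-short {i} c with i ≤? N
  ... | yes i≤N = s≤s i≤N
  ... | no i≰N =
    ⊥-elim (not-all-lengths (λ j → chain-prefix (toℕ j) (j≤i j) c))
    where
    j≤i : (j : Fin (suc N)) → toℕ j ≤ i
    j≤i j = ≤-trans (≤-pred (toℕ<n j)) (<⇒≤ (≰⇒> i≰N))

  -- The chain set Z, decidable because chain lengths are bounded.
  InZ : Fin N → Set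
  InZ z = ∃ λ (i : Fin (suc N)) → Chain (toℕ i) z

  InZ? : ∀ z → Dec (InZ z)
  InZ? z = any? (λ i → chain? (toℕ i) z)

  chain⇒InZ : ∀ {i z} → Chain i z → InZ z
  chain⇒InZ {z = z} c = fromℕ< (chain-short c) , subst (λ m → Chain m z) (sym (toℕ-fromℕ< _)) c

  y∈Z : InZ y
  y∈Z = chain⇒InZ start

  Z-closed : ∀ {z z'} → InZ z → Step z z' → InZ z'
  Z-closed (_ , c) s = chain⇒InZ (next c s)

  Z-predecessor : ∀ {z w} → InZ z → E' w z ≡ true → γ w z ≡ β →
                  ∃ λ z₁ → InZ z₁ × E' w z₁ ≡ true × γ w z₁ ≡ α
  Z-predecessor (_ , c) = go c
    where
    go : ∀ {i z w} → Chain i z → E' w z ≡ true → γ w z ≡ β →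
         ∃ λ z₁ → InZ z₁ × E' w z₁ ≡ true × γ w z₁ ≡ α
    go start wy γwy≡β = ⊥-elim (β-free _ wy γwy≡β)
    go {w = w} (next c (w' , e , a , f , b)) wz γwz≡β
      with refl ← head-inj w w' _ wz f (trans γwz≡β (sym b)) = _ , chain⇒InZ c , e , a

  swap : Fin k → Fin k
  swap = Perm.transpose α β

  swap-injective : ∀ {a b} → swap a ≡ swap b → a ≡ b
  swap-injective {a} {b} e = begin
    a                               ≡⟨ sym (Perm.transpose-inverse β α) ⟩
    Perm.transpose β α (swap a)     ≡⟨ cong (Perm.transpose β α) e ⟩
    Perm.transpose β α (swap b)     ≡⟨ Perm.transpose-inverse β α ⟩
    b                               ∎
    where open ≡-Reasoning

  data SwapView (c : Fin k) : Set where
    was-α : c ≡ α → swap c ≡ β → SwapView c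
    was-β : c ≡ β → swap c ≡ α → SwapView c
    other : c ≢ α → swap c ≡ c → SwapView c

  swapView : ∀ c → SwapView c
  swapView c with c ≟ α
  ... | yes refl = was-α refl swap-α
    where
    swap-α : swap α ≡ β
    swap-α rewrite dec-true (α ≟ α) refl = refl
  ... | no c≢α with c ≟ β
  ...   | yes refl = was-β refl swap-β
    where
    swap-β : swap β ≡ α
    swap-β rewrite dec-false (β ≟ α) c≢α | dec-true (β ≟ β) refl = refl
  ...   | no c≢β = other c≢α swap-other
    where
    swap-other : swap c ≡ c
    swap-other rewrite dec-false (c ≟ α) c≢α | dec-false (c ≟ β) c≢β = refl

  swap-to-α : ∀ {c} → swap c ≡ α → c ≡ β
  swap-to-α {c} e with swapView c
  ... | was-α c≡α s≡β = trans c≡α (trans (sym e) s≡β)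
  ... | was-β c≡β _ = c≡β
  ... | other c≢α s≡c = ⊥-elim (c≢α (trans (sym s≡c) e))

  recolour : Fin N → Fin k → Fin k
  recolour v with InZ? v
  ... | yes _ = swap
  ... | no _ = id

  recolour-injective : ∀ v {a b} → recolour v a ≡ recolour v b → a ≡ b
  recolour-injective v e with InZ? v
  ... | yes _ = swap-injective e
  ... | no _ = e

  γ' : Colouring N k
  γ' = adjustAt (λ u v → recolour v (γ u v)) x y (λ _ → α)

  γ'-xy : γ' x y ≡ α
  γ'-xy = adjustAt-here _ x y _

  γ'-old : ∀ u v → E' u v ≡ true → γ' u v ≡ recolour v (γ u v)
  γ'-old u v h =
    adjustAt-elsewhere _ {x} {y} {u} {v} _ (deleteArc-not-xy {E = E} {x} {y} {u} {v} h)

  -- α remains free at x: a recoloured out-arc xv of colour α was a β-arc into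
  -- Z, so x would have an α-arc into Z already.
  α-free-at-x : ∀ v → E' x v ≡ true → recolour v (γ x v) ≢ α
  α-free-at-x v xv e with InZ? v
  ... | no _ = α-free v xv e
  ... | yes v∈Z with Z-predecessor v∈Z xv (swap-to-α e)
  ...   | z₁ , _ , xz₁ , γxz₁≡α = α-free z₁ xz₁ γxz₁≡α

  -- α becomes free at y: arcs into y ∈ Z were not β, so after the swap not α.
  α-free-at-y : ∀ u → E' u y ≡ true → recolour y (γ u y) ≢ α
  α-free-at-y u uy e with InZ? y
  ... | yes _ = β-free u uy (swap-to-α e)
  ... | no y∉Z = y∉Z y∈Z

  split-colours : ∀ u {v v'} → InZ v → ¬ InZ v' → E' u v ≡ true → E' u v' ≡ true →
                  swap (γ u v) ≢ γ u v'
  split-colours u {v} {v'} v∈Z v'∉Z uv uv' e with swapView (γ u v)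
  ... | was-α γuv≡α s≡β = v'∉Z (Z-closed v∈Z (u , uv , γuv≡α , uv' , trans (sym e) s≡β))
  ... | was-β γuv≡β s≡α with Z-predecessor v∈Z uv γuv≡β
  ...   | z₁ , z₁∈Z , uz₁ , γuz₁≡α
          with refl ← tail-inj u z₁ v' uz₁ uv' (trans γuz₁≡α (trans (sym s≡α) e)) = v'∉Z z₁∈Z
  split-colours u v∈Z v'∉Z uv uv' e | other _ s≡c
    with refl ← tail-inj u _ _ uv uv' (trans (sym s≡c) e) = v'∉Z v∈Z

  recolour-tail-injective : TailInjective E' (λ u v → recolour v (γ u v))
  recolour-tail-injective u v v' uv uv' e with InZ? v | InZ? v'
  ... | yes _ | yes _ = tail-inj u v v' uv uv' (swap-injective e)
  ... | no _ | no _ = tail-inj u v v' uv uv' e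
  ... | yes v∈Z | no v'∉Z = ⊥-elim (split-colours u v∈Z v'∉Z uv uv' e)
  ... | no v∉Z | yes v'∈Z = ⊥-elim (split-colours u v'∈Z v∉Z uv' uv (sym e))

  γ'-proper : ProperOn E γ'
  γ'-proper = tails , heads
    where
    tails : TailInjective E γ'
    tails u v v' uv uv' e
      with deleteArc-split {E = E} {x} {y} uv | deleteArc-split {E = E} {x} {y} uv'
    ... | inj₁ (refl , refl) | inj₁ (_ , refl) = refl
    ... | inj₁ (refl , refl) | inj₂ old' =
      ⊥-elim (α-free-at-x v' old' (trans (sym (γ'-old x v' old')) (trans (sym e) γ'-xy)))
    ... | inj₂ old | inj₁ (refl , refl) =
      ⊥-elim (α-free-at-x v old (trans (sym (γ'-old x v old)) (trans e γ'-xy)))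
    ... | inj₂ old | inj₂ old' =
      recolour-tail-injective u v v' old old'
        (trans (sym (γ'-old u v old)) (trans e (γ'-old u v' old')))
    heads : HeadInjective E γ'
    heads u u' v uv u'v e
      with deleteArc-split {E = E} {x} {y} uv | deleteArc-split {E = E} {x} {y} u'v
    ... | inj₁ (refl , refl) | inj₁ (refl , _) = refl
    ... | inj₁ (refl , refl) | inj₂ old' =
      ⊥-elim (α-free-at-y u' old' (trans (sym (γ'-old u' y old')) (trans (sym e) γ'-xy)))
    ... | inj₂ old | inj₁ (refl , refl) =
      ⊥-elim (α-free-at-y u old (trans (sym (γ'-old u y old)) (trans e γ'-xy)))
    ... | inj₂ old | inj₂ old' =
      head-inj u u' v old old'
        (recolour-injective v (trans (sym (γ'-old u v old)) (trans e (γ'-old u' v old'))))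

-- Re-inserting a deleted arc xy: the degree bounds leave a colour free at x
-- and one free at y, and the Kempe step combines them.
insertArc : (E : Rel N) (x y : Fin N) → E x y ≡ true → DegreeBounded E k →
            Σ (Colouring N k) (ProperOn (deleteArc E x y)) → Σ (Colouring N k) (ProperOn E)
insertArc E x y xy∈E (out≤ , in≤) (γ , γ-proper)
  with freeColour (deleteArc E x y x) (γ x)
         (<-≤-trans (count-strict (deleteArc-⊆ x) (deleteArc-deleted E x y) xy∈E) (out≤ x))
     | freeColour (λ w → deleteArc E x y w y) (λ w → γ w y)
         (<-≤-trans (count-strict (λ w → deleteArc-⊆ w y) (deleteArc-deleted E x y) xy∈E) (in≤ y))
... | α , α-free | β , β-free = γ' , γ'-proper
  where open KempeStep E x y γ γ-proper α β α-free β-free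

-- If every vertex has at most k + 1 out-arcs and at most k + 1 in-arcs in E,
-- the arcs of E can be properly coloured with k + 1 colours (induction on the
-- number of arcs; at least one colour is needed as the default on non-arcs).
konig : (E : Rel N) → DegreeBounded E (suc k) → Σ (Colouring N (suc k)) (ProperOn E)
konig {N} {k} = measureRec size ColourableIfBounded colour
  where
  ColourableIfBounded : Rel N → Set
  ColourableIfBounded E = DegreeBounded E (suc k) → Σ (Colouring N (suc k)) (ProperOn E)
  colour : ∀ E → (∀ E' → size E' < size E → ColourableIfBounded E') → ColourableIfBounded E
  colour E rec bounded with any? (λ u → any? (λ v → E u v ≟ᵇ true))
  ... | no arcless =
    (λ _ _ → zero) , (λ u v _ uv _ _ → ⊥-elim (arcless (u , v , uv))) ,
                     (λ u _ v uv _ _ → ⊥-elim (arcless (u , v , uv)))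
  ... | yes (x , y , xy∈E) =
    insertArc E x y xy∈E bounded
      (rec (deleteArc E x y) fewer-arcs (deleteArc-bounded bounded))
    where
    fewer-arcs : size (deleteArc E x y) < size E
    fewer-arcs = size-strict {E = deleteArc E x y} deleteArc-⊆ (deleteArc-deleted E x y) xy∈E

module BitSearch (A : Rel N) (irreflexive : ∀ u → A u u ≡ false)
  (c : Colouring N k) (c-proper : ProperOn A c) where

  Monochromatic : Rel N → Fin N → Fin N → Fin N → Fin N → Set
  Monochromatic b w u v x =
    A w u ≡ true × A u v ≡ true × A v x ≡ true ×
    c w u ≡ c u v × c v x ≡ c u v × b w u ≡ b u v × b v x ≡ b u v

  monochromatic? : ∀ b → Dec (∃ λ w → ∃ λ u → ∃ λ v → ∃ λ x → Monochromatic b w u v x)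
  monochromatic? b = any? λ w → any? λ u → any? λ v → any? λ x →
    (A w u ≟ᵇ true) ×-dec (A u v ≟ᵇ true) ×-dec (A v x ≟ᵇ true) ×-dec
    (c w u ≟ c u v) ×-dec (c v x ≟ c u v) ×-dec (b w u ≟ᵇ b u v) ×-dec (b v x ≟ᵇ b u v)

  Good : Rel N → Set
  Good b = ∀ w u v x → ¬ Monochromatic b w u v x

  Continued : Rel N → Fin N → Fin N → Set
  Continued b u v = A u v ≡ true × ∃ λ x → A v x ≡ true × c v x ≡ c u v × b v x ≡ b u v

  continued? : ∀ b u v → Dec (Continued b u v)
  continued? b u v =
    (A u v ≟ᵇ true) ×-dec any? (λ x → (A v x ≟ᵇ true) ×-dec (c v x ≟ c u v) ×-dec (b v x ≟ᵇ b u v))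

  continuedRel : Rel N → Rel N
  continuedRel b u v = does (continued? b u v)

  continuedArcs : Rel N → ℕ
  continuedArcs b = size (continuedRel b)

  -- Flipping the bit of the middle arc of a monochromatic 3-path: that arc
  -- stops being continued, and no arc becomes continued.
  flip-improves : ∀ {b w u v x} → Monochromatic b w u v x →
                  continuedArcs (adjustAt b u v not) < continuedArcs b
  flip-improves {b} {w} {u} {v} {x} (wu , uv , vx , cwu≡cuv , cvx≡cuv , bwu≡buv , bvx≡buv) =
    size-strict {E = continuedRel b'} {F = continuedRel b} no-new-continued (dec-false (continued? b' u v) uv-not-continued)
      (dec-true (continued? b u v) (uv , x , vx , cvx≡cuv , bvx≡buv))
    where
    b' : Rel N
    b' = adjustAt b u v not
    vx-unchanged : b' v x ≡ b v x
    vx-unchanged = adjustAt-elsewhere b not λ { (refl , _) → irreflexive-arc uv }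
      where
      irreflexive-arc : A u u ≡ true → ⊥
      irreflexive-arc uu with trans (sym (irreflexive u)) uu
      ... | ()
    uv-not-continued : ¬ Continued b' u v
    uv-not-continued (_ , z , vz , cvz≡cuv , b'vz≡b'uv)
      with refl ← proj₁ c-proper v z x vz vx (trans cvz≡cuv (sym cvx≡cuv)) =
      not-¬ (trans vx-unchanged bvx≡buv) (trans b'vz≡b'uv (adjustAt-here b u v not))
    -- An arc other than uv continued under b' via z was continued under b:
    -- via z again, or, if the continuing arc is uv itself, via uv (then the
    -- arc is wu by head-injectivity).
    continued-elsewhere : ∀ {a₁ a₂ z} → ¬ (a₁ ≡ u × a₂ ≡ v) → A a₁ a₂ ≡ true → A a₂ z ≡ true →
                          c a₂ z ≡ c a₁ a₂ → b' a₂ z ≡ b' a₁ a₂ → Dec (a₂ ≡ u × z ≡ v) →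
                          Continued b a₁ a₂
    continued-elsewhere _ a₁u _ c≡ _ (yes (refl , refl))
      with refl ← proj₂ c-proper _ w u a₁u wu (trans (sym c≡) (sym cwu≡cuv)) =
      wu , v , uv , sym cwu≡cuv , sym bwu≡buv
    continued-elsewhere a₁a₂≢uv a₁a₂ a₂z c≡ b'≡ (no a₂z≢uv) =
      a₁a₂ , _ , a₂z , c≡ ,
      trans (sym (adjustAt-elsewhere b not a₂z≢uv)) (trans b'≡ (adjustAt-elsewhere b not a₁a₂≢uv))
    still-continued : ∀ {a₁ a₂} → Dec (a₁ ≡ u × a₂ ≡ v) → Continued b' a₁ a₂ → Continued b a₁ a₂
    still-continued (yes (refl , refl)) cont = ⊥-elim (uv-not-continued cont)
    still-continued (no a₁a₂≢uv) (a₁a₂ , z , a₂z , c≡ , b'≡) =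
      continued-elsewhere a₁a₂≢uv a₁a₂ a₂z c≡ b'≡ ((_ ≟ u) ×-dec (z ≟ v))
    no-new-continued : ∀ a₁ → continuedRel b' a₁ ⊆ continuedRel b a₁
    no-new-continued a₁ a₂ e = dec-true (continued? b a₁ a₂)
      (still-continued ((a₁ ≟ u) ×-dec (a₂ ≟ v)) (dec-sound (continued? b' a₁ a₂) e))

  good-bits : ∃ Good
  good-bits = localSearch continuedArcs Good improve (λ _ _ → false)
    where
    improve : ∀ b → Good b ⊎ ∃ λ b' → continuedArcs b' < continuedArcs b
    improve b with monochromatic? b
    ... | no none = inj₁ λ w u v x m → none (w , u , v , x , m)
    ... | yes (w , u , v , x , m) = inj₂ (adjustAt b u v not , flip-improves m)

bit : Bool → Fin 2
bit true = zero
bit false = suc zero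

bit-injective : ∀ {a a'} → bit a ≡ bit a' → a ≡ a'
bit-injective {true} {true} _ = refl
bit-injective {false} {false} _ = refl

bitColour : Bool → Fin k → Fin (2 * k)
bitColour b α = combine (bit b) α

bitColour-injective : ∀ b b' (α α' : Fin k) → bitColour b α ≡ bitColour b' α' → b ≡ b' × α ≡ α'
bitColour-injective b b' α α' e with combine-injective (bit b) α (bit b') α' e
... | bits≡ , α≡α' = bit-injective bits≡ , α≡α'

pairColouring : (D : Digraph) (c : Colouring (n D) k) (c-proper : ProperOn (adj D) c)
                (b : Rel (n D)) → BitSearch.Good (adj D) (loopless D) c c-proper b →
                HasNDColouring D (2 * k)
pairColouring {k} D c (c-tails , c-heads) b good = γ , (tails , heads) , distinguishing
  where
  colour : Fin (n D) → Fin (n D) → Fin (2 * k)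
  colour u v = bitColour (b u v) (c u v)
  γ : ArcColouring D (2 * k)
  γ u v _ = colour u v
  tails : ∀ u v w (p : Arc D u v) (q : Arc D u w) → v ≢ w → γ u v p ≢ γ u w q
  tails u v w p q v≢w e =
    v≢w (c-tails u v w p q (proj₂ (bitColour-injective (b u v) (b u w) (c u v) (c u w) e)))
  heads : ∀ u v w (p : Arc D u w) (q : Arc D v w) → u ≢ v → γ u w p ≢ γ v w q
  heads u v w p q u≢v e =
    u≢v (c-heads u v w p q (proj₂ (bitColour-injective (b u w) (b v w) (c u w) (c v w) e)))
  -- The colour of uv lies in S⁺(u) and in S⁻(v); equal pairs put it on an
  -- out-arc vx and an in-arc wu, a monochromatic 3-path w → u → v → x.
  distinguishing : NeighbourDistinguishing D γ
  distinguishing u v uv same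
    with Equivalence.to (proj₁ (same (colour u v))) (v , uv , refl)
       | Equivalence.from (proj₂ (same (colour u v))) (u , uv , refl)
  ... | x , vx , vx≡uv | w , wu , wu≡uv
    with bitColour-injective (b v x) (b u v) (c v x) (c u v) vx≡uv
       | bitColour-injective (b w u) (b u v) (c w u) (c u v) wu≡uv
  ... | bvx≡buv , cvx≡cuv | bwu≡buv , cwu≡cuv =
    good w u v x (wu , uv , vx , cwu≡cuv , cvx≡cuv , bwu≡buv , bvx≡buv)

ndColouring : (D : Digraph) → DegreeBounded (adj D) (suc k) → HasNDColouring D (2 * suc k)
ndColouring D bounded with konig (adj D) bounded
... | c , c-proper with BitSearch.good-bits (adj D) (loopless D) c c-proper
...   | b , good = pairColouring D c c-proper b good

arclessColouring : (D : Digraph) → DegreeBounded (adj D) 0 → HasNDColouring D 0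
arclessColouring D (out≤ , _) =
  (λ u v uv → ⊥-elim (noArc uv)) ,
  ((λ u _ _ uv _ _ _ → noArc uv) , (λ u _ _ uw _ _ _ → noArc uw)) ,
  (λ u v uv _ → noArc uv)
  where
  noArc : ∀ {u v} → Arc D u v → ⊥
  noArc {u} uv with ≤-trans (count-positive (adj D u) uv) (out≤ u)
  ... | ()

maxList-upper : ∀ {m xs} → m ∈ xs → m ≤ maxList xs
maxList-upper (here refl) = m≤m⊔n _ _
maxList-upper (there m∈xs) = ≤-trans (maxList-upper m∈xs) (m≤n⊔m _ _)

degreeBounded : (D : Digraph) → DegreeBounded (adj D) (Δ* D)
degreeBounded D = out≤ , in≤
  where
  out≤ : ∀ u → count (adj D u) ≤ Δ* D
  out≤ u = subst (_≤ Δ* D) (cong sum (map-tabulate id (λ v → if adj D u v then 1 else 0)))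
    (≤-trans (maxList-upper (∈-map⁺ (outdeg D) (∈-allFin u))) (m≤m⊔n _ _))
  in≤ : ∀ v → count (λ w → adj D w v) ≤ Δ* D
  in≤ v = subst (_≤ Δ* D) (cong sum (map-tabulate id (λ w → if adj D w v then 1 else 0)))
    (≤-trans (maxList-upper (∈-map⁺ (indeg D) (∈-allFin v))) (m≤n⊔m _ _))

theorem6 : (D : Digraph) → HasNDColouring D (2 * Δ* D)
theorem6 D with Δ* D | degreeBounded D
... | zero | bounded = arclessColouring D bounded
... | suc k | bounded = ndColouring D bounded
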